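{- Let $n\ge 2$ and $k\ge1$ be integers. Then $\gamma_{[k]R}(C_5\Box P_n)\le n(k+1)+2k$.
   Context: For a graph $G$ and $v\in V(G)$, $N(v)$ is the open neighborhood and $N[v]=N(v)\cup\{v\}$. For an integer $k\ge1$, a function $f:V(G)\to\{0,1,\dots,k+1\}$ is a $[k]$-Roman dominating function if for every vertex $v$ with $f(v)<k$ we have $\sum_{u\in N[v]}f(u)\ge k+|\{u\in N(v): f(u)>0\}|$. The weight of $f$ is $\sum_{v}f(v)$, and $\gamma_{[k]R}(G)$ is the minimum weight of a $[k]$-Roman dominating function on $G$. $C_m\Box P_n$ is the Cartesian product of the cycle $C_m$ (vertices $0,\dots,m-1$ mod $m$) and the path $P_n$ (vertices $0,\dots,n-1$): $(i,j)\sim(i',j')$ iff ($i=i'$ and $|j-j'|=1$) or ($j=j'$ and $i'\equiv i\pm1 \pmod m$). -}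

module Defs where

open import Data.Nat using (ℕ; zero; suc; _+_; _*_; _≤_; _<_; _≟_)
open import Data.Nat.Properties using (_≤?_)
open import Data.Fin using (Fin; toℕ)
open import Data.Product using (_×_; _,_; Σ; ∃)
open import Data.Sum using (_⊎_)
open import Data.List using (List; map; filter; length; allFin; cartesianProduct)
open import Data.Nat.ListAction using (sum)
open import Relation.Binary.PropositionalEquality using (_≡_)
open import Relation.Nullary using (Dec; yes; no; ¬_)
open import Relation.Nullary.Decidable using (_×-dec_; _⊎-dec_)
open import Relation.Unary using (Decidable)

record FinGraph : Set₁ where
  field
    V        : Set
    vertices : List V            -- every vertex exactly once
    _~_      : V → V → Set
    _~?_     : (u v : V) → Dec (u ~ v)

module _ (G : FinGraph) where
  open FinGraph G

  N : V → List V
  N v = filter (λ u → v ~? u) vertices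

  Labelling : ℕ → Set
  Labelling k = V → Fin (suc (suc k))

  val : {k : ℕ} → Labelling k → V → ℕ
  val f v = toℕ (f v)

  closedSum : {k : ℕ} → Labelling k → V → ℕ
  closedSum f v = val f v + sum (map (val f) (N v))

  activeNbrs : {k : ℕ} → Labelling k → V → ℕ
  activeNbrs f v = length (filter (λ u → 1 ≤? val f u) (N v))

  IsKRDF : (k : ℕ) → Labelling k → Set
  IsKRDF k f = ∀ v → val f v < k → k + activeNbrs f v ≤ closedSum f v

  weight : {k : ℕ} → Labelling k → ℕ
  weight f = sum (map (val f) vertices)

  -- γ_{[k]R}(G) ≤ b  ⇔  some [k]-RDF has weight ≤ b (γ is the minimum weight)
  γ[_]R≤ : ℕ → ℕ → Set
  γ[ k ]R≤ b = Σ (Labelling k) λ f → IsKRDF k f × (weight f ≤ b)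

-- Cycle C_m on vertices 0..m-1: i ~ i' iff i' ≡ i ± 1 (mod m)
CycAdj : (m : ℕ) → ℕ → ℕ → Set
CycAdj m i i' = (suc i ≡ i') ⊎ (suc i' ≡ i) ⊎ (i ≡ 0 × suc i' ≡ m) ⊎ (i' ≡ 0 × suc i ≡ m)

cycAdj? : (m i i' : ℕ) → Dec (CycAdj m i i')
cycAdj? m i i' = (suc i ≟ i') ⊎-dec (suc i' ≟ i) ⊎-dec ((i ≟ 0) ×-dec (suc i' ≟ m))
                 ⊎-dec ((i' ≟ 0) ×-dec (suc i ≟ m))

PathAdj : ℕ → ℕ → Set
PathAdj j j' = (suc j ≡ j') ⊎ (suc j' ≡ j)

pathAdj? : (j j' : ℕ) → Dec (PathAdj j j')
pathAdj? j j' = (suc j ≟ j') ⊎-dec (suc j' ≟ j)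

CPAdj : (m n : ℕ) → Fin m × Fin n → Fin m × Fin n → Set
CPAdj m n (i , j) (i' , j') =
  (toℕ i ≡ toℕ i' × PathAdj (toℕ j) (toℕ j')) ⊎ (toℕ j ≡ toℕ j' × CycAdj m (toℕ i) (toℕ i'))

CycleBoxPath : ℕ → ℕ → FinGraph
CycleBoxPath m n = record
  { V = Fin m × Fin n
  ; vertices = cartesianProduct (allFin m) (allFin n)
  ; _~_ = CPAdj m n
  ; _~?_ = λ { (i , j) (i' , j') →
      ((toℕ i ≟ toℕ i') ×-dec pathAdj? (toℕ j) (toℕ j'))
      ⊎-dec ((toℕ j ≟ toℕ j') ×-dec cycAdj? m (toℕ i) (toℕ i')) }
  }

-- Call (a , b) a centre when a + 3b ≡ 0 (mod 5). The four neighbours of a vertex of phase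
-- p = a + 3b mod 5 have phases p ± 1 and p ± 3, so on C₅ □ ℤ the centres form a perfect code:
-- every other vertex has exactly one centre neighbour. Labelling the n centres of C₅ □ Pₙ
-- (one per column) by k + 1 satisfies the [k]-Roman condition at every vertex with such a
-- neighbour, because each further active neighbour contributes at least 1 to the closed sum.
-- Cutting ℤ down to Pₙ removes the centre neighbour of just two vertices, one at each end of
-- the path; these get label k themselves, for a total weight of n(k + 1) + 2k.
module Submission where

open import Defs
open import Data.Bool using (Bool; true; false; T)
open import Data.Fin using (Fin; zero; suc; toℕ; fromℕ; fromℕ<; inject₁)
open import Data.Fin.Patterns using (0F; 1F; 2F; 3F; 4F)
open import Data.Fin.Properties using (toℕ-injective; toℕ-fromℕ<; toℕ-fromℕ; toℕ-inject₁; toℕ<n; fromℕ<-cong)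
open import Data.List using (List; []; _∷_; _++_; map; filter; length; allFin; tabulate; cartesianProduct)
open import Data.List.Membership.Propositional using (_∈_)
open import Data.List.Membership.Propositional.Properties using (∈-filter⁺; ∈-cartesianProduct⁺; ∈-allFin)
open import Data.List.Properties using (map-++; map-∘; map-tabulate; filter-accept; filter-reject)
open import Data.List.Relation.Unary.Any using (here; there)
open import Data.Nat using (ℕ; zero; suc; _+_; _*_; _∸_; _≤_; _<_; _≡ᵇ_; z≤n; s≤s; NonZero)
open import Data.Nat.DivMod using (_%_; _mod_; %-distribˡ-+; m%n%n≡m%n; [m+n]%n≡m%n; n%n≡0; m<n⇒m%n≡m)
open import Data.Nat.ListAction using (sum)
open import Data.Nat.ListAction.Properties using (sum-++)
open import Data.Nat.Properties
open import Data.Nat.Tactic.RingSolver using (solve-∀)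
open import Algebra.Properties.CommutativeMonoid.Sum +-0-commutativeMonoid
  using (sum-syntax; ∑-comm; ∑-distrib-+; sum-cong-≗; sum-init-last)
open import Data.Product using (_×_; _,_; ∃₂)
open import Data.Sum using (_⊎_; inj₁; inj₂)
open import Function using (id; _∘_)
open import Relation.Binary.PropositionalEquality
open import Relation.Nullary using (¬_; yes; no; contradiction)

countPositive : {A : Set} → (A → ℕ) → List A → ℕ
countPositive g xs = length (filter (λ x → 1 ≤? g x) xs)

module _ {A : Set} (g : A → ℕ) where

  countPositive-accept : ∀ {x} xs → 1 ≤ g x → countPositive g (x ∷ xs) ≡ suc (countPositive g xs)
  countPositive-accept xs 1≤gx = cong length (filter-accept (λ x → 1 ≤? g x) 1≤gx)

  countPositive-reject : ∀ {x} xs → ¬ 1 ≤ g x → countPositive g (x ∷ xs) ≡ countPositive g xs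
  countPositive-reject xs 1≰gx = cong length (filter-reject (λ x → 1 ≤? g x) 1≰gx)

  countPositive≤sum : ∀ xs → countPositive g xs ≤ sum (map g xs)
  countPositive≤sum []       = z≤n
  countPositive≤sum (x ∷ xs) with 1 ≤? g x
  ... | yes 1≤gx = begin
    countPositive g (x ∷ xs) ≡⟨ countPositive-accept xs 1≤gx ⟩
    suc (countPositive g xs) ≤⟨ +-mono-≤ 1≤gx (countPositive≤sum xs) ⟩
    g x + sum (map g xs)     ∎
    where open ≤-Reasoning
  ... | no 1≰gx  = begin
    countPositive g (x ∷ xs) ≡⟨ countPositive-reject xs 1≰gx ⟩
    countPositive g xs       ≤⟨ m≤n⇒m≤o+n (g x) (countPositive≤sum xs) ⟩
    g x + sum (map g xs)     ∎
    where open ≤-Reasoning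

  +countPositive≤sum : ∀ {k x} xs → x ∈ xs → k < g x → k + countPositive g xs ≤ sum (map g xs)
  +countPositive≤sum {k} {x} (x ∷ xs) (here refl) k<gx = begin
    k + countPositive g (x ∷ xs) ≡⟨ cong (k +_) (countPositive-accept xs (≤-trans (s≤s z≤n) k<gx)) ⟩
    k + suc (countPositive g xs) ≡⟨ +-suc k _ ⟩
    suc k + countPositive g xs   ≤⟨ +-mono-≤ k<gx (countPositive≤sum xs) ⟩
    g x + sum (map g xs)         ∎
    where open ≤-Reasoning
  +countPositive≤sum {k} (y ∷ xs) (there x∈xs) k<gx with 1 ≤? g y
  ... | yes 1≤gy = begin
    k + countPositive g (y ∷ xs) ≡⟨ cong (k +_) (countPositive-accept xs 1≤gy) ⟩
    k + suc (countPositive g xs) ≡⟨ +-suc k _ ⟩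
    suc (k + countPositive g xs) ≤⟨ +-mono-≤ 1≤gy (+countPositive≤sum xs x∈xs k<gx) ⟩
    g y + sum (map g xs)         ∎
    where open ≤-Reasoning
  ... | no 1≰gy  = begin
    k + countPositive g (y ∷ xs) ≡⟨ cong (k +_) (countPositive-reject xs 1≰gy) ⟩
    k + countPositive g xs       ≤⟨ m≤n⇒m≤o+n (g y) (+countPositive≤sum xs x∈xs k<gx) ⟩
    g y + sum (map g xs)         ∎
    where open ≤-Reasoning

module _ (G : FinGraph) where
  open FinGraph G

  ∈-N : ∀ {u v} → u ∈ vertices → v ~ u → u ∈ N G v
  ∈-N {v = v} u∈V v~u = ∈-filter⁺ (v ~?_) u∈V v~u

  heavyNeighbour⇒dominated : ∀ {k} (f : Labelling G k) {u v} → u ∈ N G v → k < val G f u →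
                             k + activeNbrs G f v ≤ closedSum G f v
  heavyNeighbour⇒dominated f {v = v} u∈Nv k<fu =
    m≤n⇒m≤o+n (val G f v) (+countPositive≤sum (val G f) (N G v) u∈Nv k<fu)

∈-cycleBoxPath : ∀ {m n} (v : Fin m × Fin n) → v ∈ FinGraph.vertices (CycleBoxPath m n)
∈-cycleBoxPath (i , j) = ∈-cartesianProduct⁺ (∈-allFin i) (∈-allFin j)

sum-map-cartesianProduct : {A B : Set} (g : A × B → ℕ) (xs : List A) (ys : List B) →
  sum (map g (cartesianProduct xs ys)) ≡ sum (map (λ x → sum (map (λ y → g (x , y)) ys)) xs)
sum-map-cartesianProduct g []       ys = refl
sum-map-cartesianProduct g (x ∷ xs) ys = begin
  sum (map g (map (x ,_) ys ++ cartesianProduct xs ys))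
    ≡⟨ cong sum (map-++ g (map (x ,_) ys) _) ⟩
  sum (map g (map (x ,_) ys) ++ map g (cartesianProduct xs ys))
    ≡⟨ sum-++ (map g (map (x ,_) ys)) _ ⟩
  sum (map g (map (x ,_) ys)) + sum (map g (cartesianProduct xs ys))
    ≡⟨ cong₂ _+_ (sym (cong sum (map-∘ ys))) (sum-map-cartesianProduct g xs ys) ⟩
  sum (map (λ y → g (x , y)) ys) + sum (map (λ x → sum (map (λ y → g (x , y)) ys)) xs) ∎
  where open ≡-Reasoning

sum-tabulate : ∀ n (g : Fin n → ℕ) → sum (tabulate g) ≡ ∑[ i < n ] g i
sum-tabulate zero    g = refl
sum-tabulate (suc n) g = cong (g zero +_) (sum-tabulate n (g ∘ suc))

sum-map-allFin : ∀ n (g : Fin n → ℕ) → sum (map g (allFin n)) ≡ ∑[ i < n ] g i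
sum-map-allFin n g = trans (cong sum (map-tabulate id g)) (sum-tabulate n g)

sum-map-cartesianProduct-allFin : ∀ m n (g : Fin m × Fin n → ℕ) →
  sum (map g (cartesianProduct (allFin m) (allFin n))) ≡ ∑[ i < m ] ∑[ j < n ] g (i , j)
sum-map-cartesianProduct-allFin m n g = begin
  sum (map g (cartesianProduct (allFin m) (allFin n)))
    ≡⟨ sum-map-cartesianProduct g (allFin m) (allFin n) ⟩
  sum (map (λ i → sum (map (λ j → g (i , j)) (allFin n))) (allFin m))
    ≡⟨ sum-map-allFin m _ ⟩
  ∑[ i < m ] sum (map (λ j → g (i , j)) (allFin n))
    ≡⟨ sum-cong-≗ (λ i → sum-map-allFin n (λ j → g (i , j))) ⟩
  ∑[ i < m ] ∑[ j < n ] g (i , j) ∎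
  where open ≡-Reasoning

∑-const : ∀ n c → ∑[ i < n ] c ≡ n * c
∑-const zero    c = refl
∑-const (suc n) c = cong (c +_) (∑-const n c)

∑-indicator≤ : (w : Bool → ℕ) → w false ≡ 0 → ∀ n j → ∑[ i < n ] w (toℕ i ≡ᵇ j) ≤ w true
∑-indicator≤ w w₀ zero    j       = z≤n
∑-indicator≤ w w₀ (suc n) zero    rewrite w₀ | ∑-const n 0 | *-zeroʳ n = ≤-reflexive (+-identityʳ (w true))
∑-indicator≤ w w₀ (suc n) (suc j) rewrite w₀ = ∑-indicator≤ w w₀ n j

[m%d+n]%d≡[m+n]%d : ∀ m n d .{{_ : NonZero d}} → (m % d + n) % d ≡ (m + n) % d
[m%d+n]%d≡[m+n]%d m n d = begin
  (m % d + n) % d           ≡⟨ %-distribˡ-+ (m % d) n d ⟩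
  (m % d % d + n % d) % d   ≡⟨ cong (λ x → (x + n % d) % d) (m%n%n≡m%n m d) ⟩
  (m % d + n % d) % d       ≡⟨ %-distribˡ-+ m n d ⟨
  (m + n) % d               ∎
  where open ≡-Reasoning

mod-cong : ∀ {x y} d .{{_ : NonZero d}} → x % d ≡ y % d → x mod d ≡ y mod d
mod-cong {x} {y} d eq = fromℕ<-cong (x % d) (y % d) eq _ _

module _ {m : ℕ} .{{_ : NonZero m}} where

  rotate : ℕ → Fin m → Fin m
  rotate s i = (toℕ i + s) mod m

  toℕ-rotate : ∀ s i → toℕ (rotate s i) ≡ (toℕ i + s) % m
  toℕ-rotate s i = toℕ-fromℕ< _

  rotate-zero : ∀ i → rotate 0 i ≡ i
  rotate-zero i = toℕ-injective (begin
    toℕ (rotate 0 i) ≡⟨ toℕ-rotate 0 i ⟩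
    (toℕ i + 0) % m  ≡⟨ cong (_% m) (+-identityʳ (toℕ i)) ⟩
    toℕ i % m        ≡⟨ m<n⇒m%n≡m (toℕ<n i) ⟩
    toℕ i            ∎)
    where open ≡-Reasoning

  rotate-rotate : ∀ s t i → rotate s (rotate t i) ≡ rotate (t + s) i
  rotate-rotate s t i = mod-cong m (begin
    (toℕ (rotate t i) + s) % m ≡⟨ cong (λ x → (x + s) % m) (toℕ-rotate t i) ⟩
    ((toℕ i + t) % m + s) % m  ≡⟨ [m%d+n]%d≡[m+n]%d (toℕ i + t) s m ⟩
    (toℕ i + t + s) % m        ≡⟨ cong (_% m) (+-assoc (toℕ i) t s) ⟩
    (toℕ i + (t + s)) % m      ∎)
    where open ≡-Reasoning

  rotate-period : ∀ s i → rotate (s + m) i ≡ rotate s i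
  rotate-period s i = mod-cong m (begin
    (toℕ i + (s + m)) % m ≡⟨ cong (_% m) (+-assoc (toℕ i) s m) ⟨
    (toℕ i + s + m) % m   ≡⟨ [m+n]%n≡m%n (toℕ i + s) m ⟩
    (toℕ i + s) % m       ∎)
    where open ≡-Reasoning

rotate-one-inject₁ : ∀ {n} (i : Fin n) → rotate 1 (inject₁ i) ≡ suc i
rotate-one-inject₁ {n} i = toℕ-injective (begin
  toℕ (rotate 1 (inject₁ i))  ≡⟨ toℕ-rotate 1 (inject₁ i) ⟩
  (toℕ (inject₁ i) + 1) % suc n ≡⟨ cong (λ x → (x + 1) % suc n) (toℕ-inject₁ i) ⟩
  (toℕ i + 1) % suc n         ≡⟨ cong (_% suc n) (+-comm (toℕ i) 1) ⟩
  suc (toℕ i) % suc n         ≡⟨ m<n⇒m%n≡m (s≤s (toℕ<n i)) ⟩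
  suc (toℕ i)                 ∎)
  where open ≡-Reasoning

rotate-one-last : ∀ n → rotate 1 (fromℕ n) ≡ zero
rotate-one-last n = toℕ-injective (begin
  toℕ (rotate 1 (fromℕ n))    ≡⟨ toℕ-rotate 1 (fromℕ n) ⟩
  (toℕ (fromℕ n) + 1) % suc n ≡⟨ cong (λ x → (x + 1) % suc n) (toℕ-fromℕ n) ⟩
  (n + 1) % suc n             ≡⟨ cong (_% suc n) (+-comm n 1) ⟩
  suc n % suc n               ≡⟨ n%n≡0 (suc n) ⟩
  0                           ∎)
  where open ≡-Reasoning

∑-rotate-one : ∀ {m} .{{_ : NonZero m}} (g : Fin m → ℕ) → ∑[ i < m ] g (rotate 1 i) ≡ ∑[ i < m ] g i
∑-rotate-one {suc n} g = begin
  ∑[ i < suc n ] g (rotate 1 i)                              ≡⟨ sum-init-last (g ∘ rotate 1) ⟩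
  ∑[ i < n ] g (rotate 1 (inject₁ i)) + g (rotate 1 (fromℕ n)) ≡⟨ cong₂ _+_ (sum-cong-≗ (cong g ∘ rotate-one-inject₁))
                                                                          (cong g (rotate-one-last n)) ⟩
  ∑[ i < n ] g (suc i) + g zero                              ≡⟨ +-comm _ (g zero) ⟩
  ∑[ i < suc n ] g i                                         ∎
  where open ≡-Reasoning

∑-rotate : ∀ {m} .{{_ : NonZero m}} s (g : Fin m → ℕ) → ∑[ i < m ] g (rotate s i) ≡ ∑[ i < m ] g i
∑-rotate zero    g = sum-cong-≗ (cong g ∘ rotate-zero)
∑-rotate {m} (suc s) g = begin
  ∑[ i < m ] g (rotate (suc s) i)          ≡⟨ sum-cong-≗ (λ i → cong g (rotate-rotate s 1 i)) ⟨
  ∑[ i < m ] g (rotate s (rotate 1 i))     ≡⟨ ∑-rotate-one (g ∘ rotate s) ⟩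
  ∑[ i < m ] g (rotate s i)                ≡⟨ ∑-rotate s g ⟩
  ∑[ i < m ] g i                           ∎
  where open ≡-Reasoning

phase : Fin 5 → ℕ → Fin 5
phase a b = rotate (3 * b) a

phase-rotate : ∀ d a b → phase (rotate d a) b ≡ rotate d (phase a b)
phase-rotate d a b = begin
  rotate (3 * b) (rotate d a) ≡⟨ rotate-rotate (3 * b) d a ⟩
  rotate (d + 3 * b) a        ≡⟨ cong (λ s → rotate s a) (+-comm d (3 * b)) ⟩
  rotate (3 * b + d) a        ≡⟨ rotate-rotate d (3 * b) a ⟨
  rotate d (rotate (3 * b) a) ∎
  where open ≡-Reasoning

phase-suc : ∀ a b → phase a (suc b) ≡ rotate 3 (phase a b)
phase-suc a b = begin
  rotate (3 * suc b) a        ≡⟨ cong (λ s → rotate s a) (trans (*-suc 3 b) (+-comm 3 (3 * b))) ⟩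
  rotate (3 * b + 3) a        ≡⟨ rotate-rotate 3 (3 * b) a ⟨
  rotate 3 (rotate (3 * b) a) ∎
  where open ≡-Reasoning

phase-pred : ∀ a b → phase a b ≡ rotate 2 (phase a (suc b))
phase-pred a b = begin
  rotate (3 * b) a                  ≡⟨ rotate-period (3 * b) a ⟨
  rotate (3 * b + 5) a              ≡⟨ cong (λ s → rotate s a) (3b+5≡3[1+b]+2 b) ⟩
  rotate (3 * suc b + 2) a          ≡⟨ rotate-rotate 2 (3 * suc b) a ⟨
  rotate 2 (rotate (3 * suc b) a)   ∎
  where
  open ≡-Reasoning
  3b+5≡3[1+b]+2 : ∀ b → 3 * b + 5 ≡ 3 * suc b + 2
  3b+5≡3[1+b]+2 = solve-∀

data Role : Set where
  centre orphan covered : Role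

orphanIf : Bool → Role
orphanIf true  = orphan
orphanIf false = covered

-- A vertex of phase 2 has its centre neighbour in the next column, one of phase 3 in the
-- previous column; in the last, resp. first, column of Pₙ that neighbour is missing.
phaseRole : (n b : ℕ) → Fin 5 → Role
phaseRole n b 0F = centre
phaseRole n b 2F = orphanIf (b ≡ᵇ n ∸ 1)
phaseRole n b 3F = orphanIf (b ≡ᵇ 0)
phaseRole n b _  = covered

role : ℕ → Fin 5 → ℕ → Role
role n a b = phaseRole n b (phase a b)

roleWeight : ℕ → Role → ℕ
roleWeight k centre  = suc k
roleWeight k orphan  = k
roleWeight k covered = 0

roleWeight<2+k : ∀ k r → roleWeight k r < suc (suc k)
roleWeight<2+k k centre  = ≤-refl
roleWeight<2+k k orphan  = <-trans (n<1+n k) (n<1+n (suc k))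
roleWeight<2+k k covered = s≤s z≤n

roleWeight<k⇒covered : ∀ {k} r → roleWeight k r < k → r ≡ covered
roleWeight<k⇒covered {k} centre  k+1<k = contradiction k+1<k (<-asym (n<1+n k))
roleWeight<k⇒covered {k} orphan  k<k   = contradiction k<k (<-irrefl refl)
roleWeight<k⇒covered     covered _     = refl

label : (n k : ℕ) → Labelling (CycleBoxPath 5 n) k
label n k (a , b) = fromℕ< (roleWeight<2+k k (role n a (toℕ b)))

val-label : ∀ n k a b → val (CycleBoxPath 5 n) (label n k) (a , b) ≡ roleWeight k (role n a (toℕ b))
val-label n k a b = toℕ-fromℕ< _

column-weight : ∀ n k b → ∑[ a < 5 ] roleWeight k (role n a b)
                        ≡ suc k + (roleWeight k (orphanIf (b ≡ᵇ n ∸ 1)) + roleWeight k (orphanIf (b ≡ᵇ 0)))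
column-weight n k b = trans (∑-rotate (3 * b) (roleWeight k ∘ phaseRole n b))
                            (cong (λ x → suc k + (roleWeight k (orphanIf (b ≡ᵇ n ∸ 1)) + x))
                                  (+-identityʳ (roleWeight k (orphanIf (b ≡ᵇ 0)))))

weight-label : ∀ n k → weight (CycleBoxPath 5 n) (label n k) ≤ n * (k + 1) + 2 * k
weight-label n k = begin
  weight (CycleBoxPath 5 n) (label n k)
    ≡⟨ sum-map-cartesianProduct-allFin 5 n (val (CycleBoxPath 5 n) (label n k)) ⟩
  ∑[ a < 5 ] ∑[ b < n ] val (CycleBoxPath 5 n) (label n k) (a , b)
    ≡⟨ ∑-comm (λ a b → val (CycleBoxPath 5 n) (label n k) (a , b)) ⟩
  ∑[ b < n ] ∑[ a < 5 ] val (CycleBoxPath 5 n) (label n k) (a , b)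
    ≡⟨ sum-cong-≗ (λ b → trans (sum-cong-≗ (λ a → val-label n k a b)) (column-weight n k (toℕ b))) ⟩
  ∑[ b < n ] (suc k + (last b + first b))
    ≡⟨ ∑-distrib-+ (λ _ → suc k) (λ b → last b + first b) ⟩
  ∑[ b < n ] suc k + ∑[ b < n ] (last b + first b)
    ≡⟨ cong₂ _+_ (∑-const n (suc k)) (∑-distrib-+ last first) ⟩
  n * suc k + (∑[ b < n ] last b + ∑[ b < n ] first b)
    ≤⟨ +-monoʳ-≤ (n * suc k) (+-mono-≤ (∑-indicator≤ w refl n (n ∸ 1)) (∑-indicator≤ w refl n 0)) ⟩
  n * suc k + (k + k)
    ≡⟨ cong₂ _+_ (cong (n *_) (+-comm k 1)) (cong (k +_) (+-identityʳ k)) ⟨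
  n * (k + 1) + 2 * k ∎
  where
  open ≤-Reasoning
  w : Bool → ℕ
  w = roleWeight k ∘ orphanIf
  last first : Fin n → ℕ
  last  b = w (toℕ b ≡ᵇ n ∸ 1)
  first b = w (toℕ b ≡ᵇ 0)

StripAdj : Fin 5 × ℕ → Fin 5 × ℕ → Set
StripAdj (a , b) (a' , b') = (toℕ a ≡ toℕ a' × PathAdj b b') ⊎ (b ≡ b' × CycAdj 5 (toℕ a) (toℕ a'))

cycAdj-rotate-one : ∀ (a : Fin 5) → CycAdj 5 (toℕ a) (toℕ (rotate 1 a))
cycAdj-rotate-one 0F = inj₁ refl
cycAdj-rotate-one 1F = inj₁ refl
cycAdj-rotate-one 2F = inj₁ refl
cycAdj-rotate-one 3F = inj₁ refl
cycAdj-rotate-one 4F = inj₂ (inj₂ (inj₂ (refl , refl)))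

cycAdj-rotate-four : ∀ (a : Fin 5) → CycAdj 5 (toℕ a) (toℕ (rotate 4 a))
cycAdj-rotate-four 0F = inj₂ (inj₂ (inj₁ (refl , refl)))
cycAdj-rotate-four 1F = inj₂ (inj₁ refl)
cycAdj-rotate-four 2F = inj₂ (inj₁ refl)
cycAdj-rotate-four 3F = inj₂ (inj₁ refl)
cycAdj-rotate-four 4F = inj₂ (inj₁ refl)

covered⇒centreNeighbour : ∀ {n} a b → b < n → role n a b ≡ covered →
  ∃₂ λ a' b' → b' < n × StripAdj (a , b) (a' , b') × phase a' b' ≡ 0F
covered⇒centreNeighbour a b b<n isCovered with phase a b in eq
covered⇒centreNeighbour a b b<n () | 0F
... | 1F = rotate 4 a , b , b<n , inj₂ (refl , cycAdj-rotate-four a) , trans (phase-rotate 4 a b) (cong (rotate 4) eq)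
... | 4F = rotate 1 a , b , b<n , inj₂ (refl , cycAdj-rotate-one a) , trans (phase-rotate 1 a b) (cong (rotate 1) eq)
covered⇒centreNeighbour {n} a b b<n isCovered | 2F with b ≡ᵇ n ∸ 1 in notLast
covered⇒centreNeighbour a b b<n () | 2F | true
... | false = a , suc b , 1+b<n , inj₁ (refl , inj₁ refl) , trans (phase-suc a b) (cong (rotate 3) eq)
  where 1+b<n = ≤∧≢⇒< b<n (λ 1+b≡n → subst T notLast (≡⇒≡ᵇ b (n ∸ 1) (cong (_∸ 1) 1+b≡n)))
covered⇒centreNeighbour a zero    b<n () | 3F
covered⇒centreNeighbour a (suc b) b<n _  | 3F =
  a , b , <-trans (n<1+n b) b<n , inj₁ (refl , inj₂ refl) , trans (phase-pred a b) (cong (rotate 2) eq)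

label-isKRDF : ∀ n k → IsKRDF (CycleBoxPath 5 n) k (label n k)
label-isKRDF n k (a , b) low
  with covered⇒centreNeighbour a (toℕ b) (toℕ<n b) (roleWeight<k⇒covered _ (subst (_< k) (val-label n k a b) low))
... | a' , b' , b'<n , adj , isCentre =
  heavyNeighbour⇒dominated G (label n k) (∈-N G (∈-cycleBoxPath u) adj′) heavy
  where
  G : FinGraph
  G = CycleBoxPath 5 n
  u : Fin 5 × Fin n
  u = a' , fromℕ< b'<n
  adj′ : CPAdj 5 n (a , b) u
  adj′ = subst (λ j → StripAdj (a , toℕ b) (a' , j)) (sym (toℕ-fromℕ< b'<n)) adj
  heavy : k < val G (label n k) u
  heavy = begin-strict
    k                                            <⟨ n<1+n k ⟩
    suc k                                        ≡⟨ cong (roleWeight k ∘ phaseRole n b') isCentre ⟨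
    roleWeight k (role n a' b')                  ≡⟨ cong (roleWeight k ∘ role n a') (toℕ-fromℕ< b'<n) ⟨
    roleWeight k (role n a' (toℕ (fromℕ< b'<n))) ≡⟨ val-label n k a' (fromℕ< b'<n) ⟨
    val G (label n k) u                          ∎
    where open ≤-Reasoning

-- The construction works for every n and k.
theorem4 : (n k : ℕ) → 2 ≤ n → 1 ≤ k →
    γ[_]R≤ (CycleBoxPath 5 n) k (n * (k + 1) + 2 * k)
theorem4 n k _ _ = label n k , label-isKRDF n k , weight-label n k
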